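{- Let $G=(\Sigma,I,L,\rightarrow)$ be a transition system with $\Sigma$ finite. Let $R_i$ be a preorder on $\Sigma$, and let $\sigma_i\subseteq\mathrm{post}^*(I)$ be finite. Let $\langle R,\sigma\rangle$ be the output of Algorithm 1 (described in the context) on input $G,R_i,\sigma_i$. Let $R_{\mathrm{sim}}$ and $P_{\mathrm{sim}}$ be, respectively, the simulation preorder and simulation partition of $G$ w.r.t. $R_i$. Let $P=\{\{y\in\Sigma\mid R(y)=R(x)\}\mid x\in\Sigma\}$. Then: \[R_{\mathrm{sim}}^{\mathrm{post}^*(I)}=R^{\sigma},\] and \[P_{\mathrm{sim}}^{\mathrm{post}^*(I)}\subseteq\{B\in P\mid R(B)\cap\sigma\neq\varnothing\}.\]
   Context: Transition system, operators and simulation. - $G=(\Sigma,I,L,\rightarrow)$ has states $\Sigma$, initial states $I$, finite label set $L$, and transitions $x\xrightarrow{a}y$. - $\mathrm{pre}_a(Y)=\{x\mid\exists y\in Y.\ x\xrightarrow{a}y\}$. - $\mathrm{post}(X)=\{y\mid \exists x\in X,a\in L.\ x\xrightarrow{a}y\}$ and $\mathrm{post}^*(X)=\bigcup_n\mathrm{post}^n(X)$. - A relation $R\subseteq\Sigma\times\Sigma$ is a simulation w.r.t. a preorder $R_i$ if $R\subseteq R_i$ and, whenever $(s,t)\in R$ and $s\xrightarrow{a}s'$, there is $t'$ with $t\xrightarrow{a}t'$ and $(s',t')\in R$. - $R_{\mathrm{sim}}$ is the greatest simulation, and $P_{\mathrm{sim}}$ is the partition induced by $R_{\mathrm{sim}}\cap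 R_{\mathrm{sim}}^{ -1}$. Notation for relations and partitions. - For a relation $R$: $R(x)=\{y\mid(x,y)\in R\}$ is the principal of $x$, and $R(S)=\bigcup_{x\in S}R(x)$. - $R^S=\{R(x)\mid x\in\Sigma,\ R(x)\cap S\neq\varnothing\}$. - For a partition $P$: $P^S=\{B\in P\mid B\cap S\neq\varnothing\}$. Algorithm 1. Initially $R:=R_i$ and $\sigma:=\sigma_i$. The algorithm repeats the following forever. - Compute \[U=\{R(x)\mid R(x)\cap\sigma=\varnothing,\ R(x)\cap(I\cup\mathrm{post}(\sigma))\neq\varnothing\}\] and \[V=\{\langle a,x,x'\rangle\in L\times\Sigma^2\mid R(x)\cap\sigma\neq\varnothing,\ x\xrightarrow{a}x',\ R(x)\not\subseteq\mathrm{pre}_a(R(x'))\}.\] - Then nondeterministically execute one enabled guarded command: - (Search) if $U\neq\varnothing$: choose $R(x)\in U$ and $s\in R(x)\cap(I\cup\mathrm{post}(\sigma))$, and set $\sigma:=\sigma\cup\{s\}$. - (Refine) if $V\neq\varnothing$: choose $\langle a,x,x'\rangle\in V$ and set $R(x):=R(x)\cap\mathrm{pre}_a(R(x'))$; only the principal of $x$ changes. - if $U=\varnothing$ and $V=\varnothing$: return $\langle R,\sigma\rangle$. -}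

module Defs where

open import Data.Nat using (ℕ)
open import Data.Fin using (Fin; _≟_)
open import Data.Bool using (Bool; true; false; _∧_; _∨_; if_then_else_)
open import Data.List using (allFin)
open import Data.Bool.ListAction using () renaming (any to anyL)
open import Data.Product using (Σ; ∃; _×_; _,_)
open import Data.Sum using (_⊎_)
open import Relation.Nullary using (¬_; ⌊_⌋)
open import Relation.Binary.PropositionalEquality using (_≡_)
open import Relation.Binary.Construct.Closure.ReflexiveTransitive using (Star)
open import Level using (Level)
open import Function.Bundles using (_⇔_)

-- States Σ = Fin n, labels L = Fin m.  Subsets of Σ and relations on Σ
-- are decidable (Bool-valued); on a finite set this loses no generality.
BSub : ℕ → Set
BSub n = Fin n → Bool

BRel : ℕ → Set
BRel n = Fin n → Fin n → Bool

record TS (n m : ℕ) : Set where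
  field
    init  : BSub n
    trans : Fin m → Fin n → Fin n → Bool
open TS public

module _ {n m : ℕ} (G : TS n m) where

  Pre : Fin m → BSub n → Fin n → Set
  Pre a Y x = ∃ λ y → Y y ≡ true × trans G a x y ≡ true

  Post : BSub n → Fin n → Set
  Post X y = ∃ λ x → ∃ λ (a : Fin m) → X x ≡ true × trans G a x y ≡ true

  data Reach : Fin n → Set where
    here : ∀ {x} → init G x ≡ true → Reach x
    step : ∀ {x y} (a : Fin m) → Reach x → trans G a x y ≡ true → Reach y

  IsSimulation : BRel n → BRel n → Set
  IsSimulation Ri R =
    (∀ x y → R x y ≡ true → Ri x y ≡ true) ×
    (∀ s t (a : Fin m) s' → R s t ≡ true → trans G a s s' ≡ true →
       ∃ λ t' → trans G a t t' ≡ true × R s' t' ≡ true)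

  IsGreatestSimulation : BRel n → BRel n → Set
  IsGreatestSimulation Ri Rsim =
    IsSimulation Ri Rsim ×
    (∀ R → IsSimulation Ri R → ∀ x y → R x y ≡ true → Rsim x y ≡ true)

Meets : ∀ {n} → BSub n → (Fin n → Set) → Set
Meets A S = ∃ λ z → A z ≡ true × S z

_∈ᵇ : ∀ {n} → BSub n → Fin n → Set
(σ ∈ᵇ) z = σ z ≡ true

anyFin : ∀ {n} → (Fin n → Bool) → Bool
anyFin {n} f = anyL f (allFin n)

module Alg {n m : ℕ} (G : TS n m) where

  preB : Fin m → BSub n → BSub n
  preB a Y x = anyFin (λ y → Y y ∧ trans G a x y)

  addB : BSub n → Fin n → BSub n
  addB σ s y = σ y ∨ ⌊ y ≟ s ⌋

  refineB : BRel n → Fin m → Fin n → Fin n → BRel n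
  refineB R a x x' z y =
    if ⌊ z ≟ x ⌋ then (R x y ∧ preB a (R x') y) else R z y

  IPost : BSub n → Fin n → Set
  IPost σ z = init G z ≡ true ⊎ Post G σ z

  InU : BRel n → BSub n → Fin n → Set
  InU R σ x = ¬ Meets (R x) (σ ∈ᵇ) × Meets (R x) (IPost σ)

  InV : BRel n → BSub n → Fin m → Fin n → Fin n → Set
  InV R σ a x x' =
    Meets (R x) (σ ∈ᵇ) × trans G a x x' ≡ true ×
    ¬ (∀ y → R x y ≡ true → Pre G a (R x') y)

  Config : Set
  Config = BRel n × BSub n

  data Step : Config → Config → Set where
    search : ∀ {R σ} x s → InU R σ x → R x s ≡ true → IPost σ s →
             Step (R , σ) (R , addB σ s)
    refine : ∀ {R σ} a x x' → InV R σ a x x' →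
             Step (R , σ) (refineB R a x x' , σ)

  Terminal : Config → Set
  Terminal (R , σ) =
    (∀ x → ¬ InU R σ x) × (∀ a x x' → ¬ InV R σ a x x')

  Output : BRel n → BSub n → BRel n → BSub n → Set
  Output Ri σi R σ = Star Step (Ri , σi) (R , σ) × Terminal (R , σ)

InFamily : ∀ {n} → BRel n → (Fin n → Set) → BSub n → Set
InFamily R S Y = ∃ λ x → (∀ y → R x y ≡ Y y) × Meets (R x) S

SimBlock : ∀ {n} → BRel n → Fin n → Fin n → Set
SimBlock Rsim x y = Rsim x y ≡ true × Rsim y x ≡ true

PBlock : ∀ {n} → BRel n → Fin n → Fin n → Set
PBlock R x y = ∀ z → R y z ≡ R x z

InPartition : ∀ {n} → (Fin n → Fin n → Set) → (Fin n → Set) → (Fin n → Set) → Set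
InPartition blk S B = (∃ λ x → ∀ y → B y ⇔ blk x y) × (∃ λ z → B z × S z)

ImageMeets : ∀ {n} → BRel n → (Fin n → Set) → BSub n → Set
ImageMeets R B σ = ∃ λ b → ∃ λ s → B b × R b s ≡ true × σ s ≡ true

-- Algorithm 1 maintains the invariant  Rsim ⊆ R,  R ; Rsim ⊆ R,  R ⊆ Ri,
-- σ ⊆ post*(I).  Call x active when R(x) meets σ.  At termination U = ∅
-- makes every principal meeting I ∪ post(σ) active, hence every reachable
-- state is active, and V = ∅ makes R restricted to active rows a simulation,
-- so R(x) = Rsim(x) for active x.  Both claims of the theorem follow by
-- comparing principals of active states.

module Submission where

open import Defs
open import Data.Nat using (ℕ)
open import Data.Fin using (Fin; _≟_)
open import Data.Fin.Properties using (any?)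
open import Data.Bool using (Bool; true; false; _∧_; _∨_)
import Data.Bool as Bool
open import Data.Bool.Properties using (T-≡)
open import Data.List using (allFin)
open import Data.List.Membership.Propositional using (lose)
open import Data.List.Membership.Propositional.Properties using (∈-allFin)
open import Data.List.Relation.Unary.Any using (satisfied)
open import Data.List.Relation.Unary.Any.Properties using (any⁺; any⁻)
open import Data.Product using (∃; _×_; _,_; proj₁; proj₂; map₂; uncurry)
open import Data.Sum using (_⊎_; inj₁; inj₂)
import Data.Sum as Sum
open import Data.Empty using (⊥-elim)
open import Relation.Nullary using (Dec; yes; no; ⌊_⌋)
open import Relation.Nullary.Decidable using (_×-dec_)
open import Relation.Binary.PropositionalEquality using (_≡_; refl; sym; subst) renaming (trans to ≡-trans)
open import Relation.Binary.Structures using (IsPreorder)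
open import Relation.Binary.Construct.Closure.ReflexiveTransitive using (Star; ε; _◅_)
open import Function.Bundles using (_⇔_; mk⇔; Equivalence)
open import Function.Properties.Equivalence using () renaming (trans to ⇔-trans)

∧-true⁺ : ∀ {a b} → a ≡ true → b ≡ true → a ∧ b ≡ true
∧-true⁺ refl refl = refl

∧-true⁻ : ∀ {a b} → a ∧ b ≡ true → a ≡ true × b ≡ true
∧-true⁻ {true} eq = refl , eq

∨-true⁻ : ∀ {a b} → a ∨ b ≡ true → a ≡ true ⊎ b ≡ true
∨-true⁻ {true}  _  = inj₁ refl
∨-true⁻ {false} eq = inj₂ eq

true⇔⇒≡ : ∀ {a b} → (a ≡ true → b ≡ true) → (b ≡ true → a ≡ true) → a ≡ b
true⇔⇒≡ {true}          to _    = sym (to refl)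
true⇔⇒≡ {false} {true}  _  from = from refl
true⇔⇒≡ {false} {false} _  _    = refl

≟-diag : ∀ {n} (x : Fin n) → ⌊ x ≟ x ⌋ ≡ true
≟-diag x with x ≟ x
... | yes _  = refl
... | no x≢x = ⊥-elim (x≢x refl)

≟-true⇒≡ : ∀ {n} {x y : Fin n} → ⌊ x ≟ y ⌋ ≡ true → x ≡ y
≟-true⇒≡ {x = x} {y} eq with x ≟ y
... | yes x≡y = x≡y

anyFin-true⁺ : ∀ {n} (f : Fin n → Bool) x → f x ≡ true → anyFin f ≡ true
anyFin-true⁺ f x fx =
  Equivalence.to T-≡ (any⁺ f (lose (∈-allFin x) (Equivalence.from T-≡ fx)))

anyFin-true⁻ : ∀ {n} (f : Fin n → Bool) → anyFin f ≡ true → ∃ λ x → f x ≡ true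
anyFin-true⁻ {n} f eq =
  map₂ (Equivalence.to T-≡) (satisfied (any⁻ f (allFin n) (Equivalence.from T-≡ eq)))

meets? : ∀ {n} (A σ : BSub n) → Dec (Meets A (σ ∈ᵇ))
meets? A σ = any? (λ z → (A z Bool.≟ true) ×-dec (σ z Bool.≟ true))

module AlgProperties {n m : ℕ} (G : TS n m) where
  open Alg G

  pre? : ∀ a Y x → Dec (Pre G a Y x)
  pre? a Y x = any? (λ y → (Y y Bool.≟ true) ×-dec (trans G a x y Bool.≟ true))

  preB⁺ : ∀ {a Y x} → Pre G a Y x → preB a Y x ≡ true
  preB⁺ {a} {Y} {x} (y , Yy , x→y) =
    anyFin-true⁺ (λ y → Y y ∧ trans G a x y) y (∧-true⁺ Yy x→y)

  preB⁻ : ∀ {a Y x} → preB a Y x ≡ true → Pre G a Y x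
  preB⁻ eq = map₂ ∧-true⁻ (anyFin-true⁻ _ eq)

  refineB⁺ : ∀ R a x x' z y → R z y ≡ true → (z ≡ x → Pre G a (R x') y) →
             refineB R a x x' z y ≡ true
  refineB⁺ R a x x' z y Rzy pre with z ≟ x
  ... | yes refl = ∧-true⁺ Rzy (preB⁺ (pre refl))
  ... | no _    = Rzy

  refineB⁻ : ∀ R a x x' z y → refineB R a x x' z y ≡ true →
             R z y ≡ true × (z ≡ x → Pre G a (R x') y)
  refineB⁻ R a x x' z y eq with z ≟ x
  ... | yes refl = proj₁ (∧-true⁻ eq) , λ _ → preB⁻ (proj₂ (∧-true⁻ eq))
  ... | no z≢x   = eq , λ z≡x → ⊥-elim (z≢x z≡x)

  addB⁻ : ∀ σ s z → addB σ s z ≡ true → σ z ≡ true ⊎ z ≡ s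
  addB⁻ σ s z eq = Sum.map₂ ≟-true⇒≡ (∨-true⁻ eq)

module Correctness {n m : ℕ} (G : TS n m) (Ri : BRel n)
  (Ri-preorder : IsPreorder _≡_ (λ x y → Ri x y ≡ true))
  (Rsim : BRel n) (Rsim-greatest : IsGreatestSimulation G Ri Rsim) where

  open Alg G
  open AlgProperties G

  Rsim⊆Ri : ∀ {x y} → Rsim x y ≡ true → Ri x y ≡ true
  Rsim⊆Ri = proj₁ (proj₁ Rsim-greatest) _ _

  Rsim-simulates : ∀ {s t a s'} → Rsim s t ≡ true → trans G a s s' ≡ true →
                   ∃ λ t' → trans G a t t' ≡ true × Rsim s' t' ≡ true
  Rsim-simulates = proj₂ (proj₁ Rsim-greatest) _ _ _ _

  ⊆Rsim : ∀ {S} → IsSimulation G Ri S → ∀ {x y} → S x y ≡ true → Rsim x y ≡ true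
  ⊆Rsim S-sim = proj₂ Rsim-greatest _ S-sim _ _

  Id : BRel n
  Id x y = ⌊ x ≟ y ⌋

  Id-isSimulation : IsSimulation G Ri Id
  Id-isSimulation =
      (λ x y x≟y → subst (λ y → Ri x y ≡ true) (≟-true⇒≡ x≟y) (IsPreorder.refl Ri-preorder))
    , λ s t a s' s≟t s→s' →
        s' , subst (λ t → trans G a t s' ≡ true) (≟-true⇒≡ s≟t) s→s' , ≟-diag s'

  Rsim-refl : ∀ x → Rsim x x ≡ true
  Rsim-refl x = ⊆Rsim Id-isSimulation (≟-diag x)

  record Invariant (R : BRel n) (σ : BSub n) : Set where
    field
      Rsim⊆R    : ∀ {x y} → Rsim x y ≡ true → R x y ≡ true
      R-Rsim⊆R  : ∀ {x y z} → R x y ≡ true → Rsim y z ≡ true → R x z ≡ true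
      R⊆Ri      : ∀ {x y} → R x y ≡ true → Ri x y ≡ true
      σ⊆post*I  : ∀ {s} → σ s ≡ true → Reach G s

    R-refl : ∀ x → R x x ≡ true
    R-refl x = Rsim⊆R (Rsim-refl x)

    IPost⊆post*I : ∀ {s} → IPost σ s → Reach G s
    IPost⊆post*I (inj₁ Is)                = here Is
    IPost⊆post*I (inj₂ (x , a , σx , x→s)) = step a (σ⊆post*I σx) x→s

    Rsim-pre : ∀ {a x x' y} → trans G a x x' ≡ true → Rsim x y ≡ true → Pre G a (R x') y
    Rsim-pre x→x' Rxy with Rsim-simulates Rxy x→x'
    ... | y' , y→y' , Rx'y' = y' , Rsim⊆R Rx'y' , y→y'

    pre-Rsim-closed : ∀ {a x' y w} → Pre G a (R x') y → Rsim y w ≡ true → Pre G a (R x') w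
    pre-Rsim-closed (y' , Rx'y' , y→y') Rsim-yw with Rsim-simulates Rsim-yw y→y'
    ... | w' , w→w' , Rsim-y'w' = w' , R-Rsim⊆R Rx'y' Rsim-y'w' , w→w'

  open Invariant

  invariant-initial : ∀ {σi} → (∀ x → σi x ≡ true → Reach G x) → Invariant Ri σi
  invariant-initial σi⊆post*I = record
    { Rsim⊆R   = Rsim⊆Ri
    ; R-Rsim⊆R = λ Rixy Rsim-yz → IsPreorder.trans Ri-preorder Rixy (Rsim⊆Ri Rsim-yz)
    ; R⊆Ri     = λ Rixy → Rixy
    ; σ⊆post*I = σi⊆post*I _
    }

  invariant-step : ∀ {R σ R' σ'} → Step (R , σ) (R' , σ') → Invariant R σ → Invariant R' σ'
  invariant-step {σ = σ} (search _ s _ _ IPost-s) inv = record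
    { Rsim⊆R   = Rsim⊆R inv
    ; R-Rsim⊆R = R-Rsim⊆R inv
    ; R⊆Ri     = R⊆Ri inv
    ; σ⊆post*I = λ {z} σ'z → σ∪s⊆post*I (addB⁻ σ s z σ'z)
    }
    where
      σ∪s⊆post*I : ∀ {z} → σ z ≡ true ⊎ z ≡ s → Reach G z
      σ∪s⊆post*I (inj₁ σz)  = σ⊆post*I inv σz
      σ∪s⊆post*I (inj₂ refl) = IPost⊆post*I inv IPost-s
  invariant-step {R} (refine a x x' (_ , x→x' , _)) inv = record
    { Rsim⊆R   = λ {z} {y} Rsim-zy → refineB⁺ R a x x' z y (Rsim⊆R inv Rsim-zy)
                                        λ { refl → Rsim-pre inv x→x' Rsim-zy }
    ; R-Rsim⊆R = λ {z} {y} {w} R'zy Rsim-yw →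
        let Rzy , pre-y = refineB⁻ R a x x' z y R'zy
        in  refineB⁺ R a x x' z w (R-Rsim⊆R inv Rzy Rsim-yw)
                     λ z≡x → pre-Rsim-closed inv (pre-y z≡x) Rsim-yw
    ; R⊆Ri     = λ {z} {y} R'zy → R⊆Ri inv (proj₁ (refineB⁻ R a x x' z y R'zy))
    ; σ⊆post*I = σ⊆post*I inv
    }

  invariant-run : ∀ {c d} → Star Step c d → uncurry Invariant c → uncurry Invariant d
  invariant-run ε        inv = inv
  invariant-run (s ◅ ss) inv = invariant-run ss (invariant-step s inv)

  module Terminated {R : BRel n} {σ : BSub n}
    (inv : Invariant R σ) (terminal : Terminal (R , σ)) where

    Active : Fin n → Set
    Active x = Meets (R x) (σ ∈ᵇ)

    active-of-IPost : ∀ {x z} → R x z ≡ true → IPost σ z → Active x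
    active-of-IPost {x} {z} Rxz IPost-z with meets? (R x) σ
    ... | yes active  = active
    ... | no inactive = ⊥-elim (proj₁ terminal x (inactive , z , Rxz , IPost-z))

    active-pre : ∀ {a x x' y} → Active x → trans G a x x' ≡ true → R x y ≡ true →
                 Pre G a (R x') y
    active-pre {a} {x} {x'} {y} active x→x' Rxy with pre? a (R x') y
    ... | yes pre = pre
    ... | no ¬pre = ⊥-elim (proj₂ terminal a x x' (active , x→x' , λ Rx⊆pre → ¬pre (Rx⊆pre y Rxy)))

    active-step : ∀ {a x x'} → Active x → trans G a x x' ≡ true → Active x'
    active-step active@(s , Rxs , σs) x→x' with active-pre active x→x' Rxs
    ... | s' , Rx's' , s→s' = active-of-IPost Rx's' (inj₂ (s , _ , σs , s→s'))

    post*I⊆active : ∀ {z} → Reach G z → Active z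
    post*I⊆active (here Iz)          = active-of-IPost (R-refl inv _) (inj₁ Iz)
    post*I⊆active (step a reach z→z') = active-step (post*I⊆active reach) z→z'

    ActiveR : BRel n
    ActiveR x y = ⌊ meets? (R x) σ ⌋ ∧ R x y

    ActiveR⁺ : ∀ x y → Active x → R x y ≡ true → ActiveR x y ≡ true
    ActiveR⁺ x y active Rxy with meets? (R x) σ
    ... | yes _       = Rxy
    ... | no inactive = ⊥-elim (inactive active)

    ActiveR⁻ : ∀ x y → ActiveR x y ≡ true → Active x × R x y ≡ true
    ActiveR⁻ x y eq with meets? (R x) σ
    ... | yes active = active , eq

    ActiveR-isSimulation : IsSimulation G Ri ActiveR
    ActiveR-isSimulation =
        (λ x y eq → R⊆Ri inv (proj₂ (ActiveR⁻ x y eq)))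
      , λ s t a s' eq s→s' →
          let active , Rst        = ActiveR⁻ s t eq
              t' , Rs't' , t→t'   = active-pre active s→s' Rst
          in  t' , t→t' , ActiveR⁺ s' t' (active-step active s→s') Rs't'

    active-R⊆Rsim : ∀ {x y} → Active x → R x y ≡ true → Rsim x y ≡ true
    active-R⊆Rsim {x} {y} active Rxy = ⊆Rsim ActiveR-isSimulation (ActiveR⁺ x y active Rxy)

    active-R≡Rsim : ∀ {x} → Active x → ∀ y → R x y ≡ Rsim x y
    active-R≡Rsim active y = true⇔⇒≡ (active-R⊆Rsim active) (Rsim⊆R inv)

    Rsim-R-antitone : ∀ {x y w} → Rsim x y ≡ true → Active y → R y w ≡ true → R x w ≡ true
    Rsim-R-antitone Rsim-xy active-y Ryw =
      R-Rsim⊆R inv (Rsim⊆R inv Rsim-xy) (active-R⊆Rsim active-y Ryw)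

    Rsim-active : ∀ {x y} → Rsim x y ≡ true → Active y → Active x
    Rsim-active Rsim-xy active-y@(s , Rys , σs) = s , Rsim-R-antitone Rsim-xy active-y Rys , σs

    SimBlock⇔PBlock : ∀ {x} → Active x → ∀ y → SimBlock Rsim x y ⇔ PBlock R x y
    SimBlock⇔PBlock {x} active-x y = mk⇔ to from
      where
        to : SimBlock Rsim x y → PBlock R x y
        to (Rsim-xy , Rsim-yx) w =
          let active-y = Rsim-active Rsim-yx active-x
          in  true⇔⇒≡ (Rsim-R-antitone Rsim-xy active-y) (Rsim-R-antitone Rsim-yx active-x)
        from : PBlock R x y → SimBlock Rsim x y
        from Ry≡Rx =
          let s , Rxs , σs = active-x
              active-y     = s , ≡-trans (Ry≡Rx s) Rxs , σs
          in    active-R⊆Rsim active-x (≡-trans (sym (Ry≡Rx y)) (R-refl inv y))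
              , active-R⊆Rsim active-y (≡-trans (Ry≡Rx x) (R-refl inv x))

    reachable-principals : ∀ Y → InFamily Rsim (Reach G) Y ⇔ InFamily R (σ ∈ᵇ) Y
    reachable-principals Y = mk⇔ to from
      where
        to : InFamily Rsim (Reach G) Y → InFamily R (σ ∈ᵇ) Y
        to (x , Rsim-x≡Y , z , Rsim-xz , reach-z) =
          let active = Rsim-active Rsim-xz (post*I⊆active reach-z)
          in  x , (λ y → ≡-trans (active-R≡Rsim active y) (Rsim-x≡Y y)) , active
        from : InFamily R (σ ∈ᵇ) Y → InFamily Rsim (Reach G) Y
        from (x , Rx≡Y , active@(s , Rxs , σs)) =
            x , (λ y → ≡-trans (sym (active-R≡Rsim active y)) (Rx≡Y y))
          , s , active-R⊆Rsim active Rxs , σ⊆post*I inv σs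

    reachable-blocks : ∀ B → InPartition (SimBlock Rsim) (Reach G) B →
                       (∃ λ x → ∀ y → B y ⇔ PBlock R x y) × ImageMeets R B σ
    reachable-blocks B ((x , B≡[x]) , z , Bz , reach-z) =
        (x , λ y → ⇔-trans (B≡[x] y) (SimBlock⇔PBlock active-x y))
      , x , s , Equivalence.from (B≡[x] x) (Rsim-refl x , Rsim-refl x) , Rxs , σs
      where
        active-x = Rsim-active (proj₁ (Equivalence.to (B≡[x] z) Bz)) (post*I⊆active reach-z)
        s   = proj₁ active-x
        Rxs = proj₁ (proj₂ active-x)
        σs  = proj₂ (proj₂ active-x)

theorem3 : ∀ {n m : ℕ} (G : TS n m) (Ri : BRel n) (σi : BSub n) →
    IsPreorder _≡_ (λ x y → Ri x y ≡ true) →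
    (∀ x → σi x ≡ true → Reach G x) →
    (R : BRel n) (σ : BSub n) → Alg.Output G Ri σi R σ →
    (Rsim : BRel n) → IsGreatestSimulation G Ri Rsim →
    (∀ (Y : BSub n) → InFamily Rsim (Reach G) Y ⇔ InFamily R (λ z → σ z ≡ true) Y) ×
    (∀ (B : Fin n → Set) → InPartition (SimBlock Rsim) (Reach G) B →
       (∃ λ x → ∀ y → B y ⇔ PBlock R x y) × ImageMeets R B σ)
theorem3 G Ri σi Ri-preorder σi⊆post*I R σ (run , terminal) Rsim Rsim-greatest =
  reachable-principals , reachable-blocks
  where
    open Correctness G Ri Ri-preorder Rsim Rsim-greatest
    open Terminated (invariant-run run (invariant-initial σi⊆post*I)) terminal
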